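{- Let $w$ be a minimal element of $\mathcal{C}_n$. Then every crowded subset of $\mathrm{Row}_2(P(w))$ contains the largest element of $\mathrm{Row}_2(P(w))$.
   Context: A permutation is fully commutative iff it avoids $321$. $P(w)$ is the RSK insertion tableau and $\mathrm{Row}_2(P(w))$ the set of its second-row entries. A set $L$ of integers is crowded if there exist integers $x>0$, $y$ with $|[y,y+2x]\cap L|>x+1$. $\mathcal{C}_n$ is the set of fully commutative $w\in S_n$ with $\mathrm{Row}_2(P(w))$ crowded, and minimal means minimal in $\mathcal{C}_n$ with respect to the right weak order (the transitive closure of $u<us_i$ whenever $\ell(us_i)>\ell(u)$). -}

module Defs where

open import Data.Nat using (ℕ; zero; suc; _+_; _*_; _<_; _≤_; _<ᵇ_)
open import Data.Bool using (Bool; true; false; if_then_else_)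
open import Data.Integer as ℤ using (ℤ; +_)
open import Data.List using (List; []; _∷_; _++_; length; filter; map; upTo; foldl)
import Data.List.Relation.Unary.Any as Any
open import Data.List.Membership.Propositional using (_∈_)
open import Data.List.Relation.Binary.Permutation.Propositional using (_↭_)
open import Data.List.Relation.Binary.Sublist.Propositional using (_⊆_)
open import Data.Maybe using (Maybe; just; nothing)
open import Data.Product using (_×_; _,_; ∃; ∃-syntax)
open import Relation.Nullary using (¬_)
open import Relation.Nullary.Decidable using (⌊_⌋)
open import Relation.Binary.PropositionalEquality using (_≡_)
open import Relation.Binary.Construct.Closure.Transitive using (TransClosure)
import Data.Nat.Properties as ℕP

IsPerm : ℕ → List ℕ → Set
IsPerm n w = w ↭ map suc (upTo n)

-- Fully commutative = 321-avoiding: no subsequence c b a with c > b > a.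
Avoids321 : List ℕ → Set
Avoids321 w = ¬ (∃[ a ] ∃[ b ] ∃[ c ] ((c ∷ b ∷ a ∷ []) ⊆ w × b < c × a < b))

insertRow : ℕ → List ℕ → List ℕ × Maybe ℕ
insertRow x [] = (x ∷ [] , nothing)
insertRow x (y ∷ ys) with x <ᵇ y
... | true  = (x ∷ ys , just y)
... | false with insertRow x ys
...   | (r , b) = (y ∷ r , b)

insertTab : ℕ → List (List ℕ) → List (List ℕ)
insertTab x [] = (x ∷ []) ∷ []
insertTab x (r ∷ rs) with insertRow x r
... | (r' , nothing) = r' ∷ rs
... | (r' , just b)  = r' ∷ insertTab b rs

-- P(w): the insertion tableau, inserting w(1), w(2), ..., w(n) in order.
-- Represented as its list of rows (top row first).
P : List ℕ → List (List ℕ)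
P w = foldl (λ T x → insertTab x T) [] w

Row₂ : List (List ℕ) → List ℕ
Row₂ (_ ∷ r ∷ _) = r
Row₂ _ = []

countIn : ℕ → ℤ → List ℕ → ℕ
countIn x y L =
  length (filter (λ t → Any.any? (λ m → (+ m) ℤ.≟ (y ℤ.+ (+ t))) L)
                 (upTo (suc (2 * x))))

Crowded : List ℕ → Set
Crowded L = ∃[ x ] ∃[ y ] (0 < x × x + 1 < countIn x y L)

inv : List ℕ → ℕ
inv [] = 0
inv (x ∷ xs) = length (filter (λ y → y ℕP.<? x) xs) + inv xs

-- u s_i : swap positions i and i+1 (1-indexed) in one-line notation.
swapAt : ℕ → List ℕ → List ℕ
swapAt (suc zero) (a ∷ b ∷ xs) = b ∷ a ∷ xs
swapAt (suc (suc i)) (x ∷ xs) = x ∷ swapAt (suc i) xs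
swapAt _ xs = xs

WeakStep : ℕ → List ℕ → List ℕ → Set
WeakStep n u v = ∃[ i ] (1 ≤ i × suc i ≤ n × v ≡ swapAt i u × inv u < inv v)

_<W[_]_ : List ℕ → ℕ → List ℕ → Set
u <W[ n ] v = TransClosure (WeakStep n) u v

InC : ℕ → List ℕ → Set
InC n w = IsPerm n w × Avoids321 w × Crowded (Row₂ (P w))

MinimalC : ℕ → List ℕ → Set
MinimalC n w = InC n w × (∀ v → InC n v → ¬ (v <W[ n ] w))

_⊆ˢ_ : List ℕ → List ℕ → Set
S ⊆ˢ T = ∀ {m} → m ∈ S → m ∈ T

-- For a 321-avoiding word Schensted insertion produces at most two rows, and an entry bumped
-- from the first row exceeds every entry of the second (otherwise a 321-pattern appears), so it
-- is simply appended there. Let M be the largest entry of the second row of P(w). Entries only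
-- reach the second row by being bumped by a smaller later entry, so w has a descent p > q at or
-- after the position of M; by 321-avoidance every entry before p is smaller than p. The swapped
-- word v = w s_i is a 321-avoiding permutation covered by w in the right weak order. Inserting
-- v either gives the same tableau as w, or p = M and M is held back in the first row, so that
-- the second row of P(v) contains that of P(w) except possibly M. If a crowded S ⊆ Row₂(P(w))
-- avoided M, then v would lie in 𝒞_n below w, contradicting minimality.

module Submission where

open import Defs
open import Data.Bool using (true; false)
open import Data.Empty using (⊥-elim)
open import Data.Integer as ℤ using (+_)
open import Data.List using (List; []; _∷_; _++_; [_]; foldl; length; filter; fromMaybe; upTo)
open import Data.List.Properties
  using (++-assoc; ++-identityʳ; foldl-++; length-map; length-upTo; filter-accept; filter-reject)
open import Data.List.Membership.Propositional using (_∈_; _∉_)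
open import Data.List.Membership.Propositional.Properties using (∈-++⁺ˡ; ∈-++⁺ʳ; ∈-++⁻; ∈-∃++)
open import Data.List.Relation.Unary.All as All using (All; []; _∷_)
import Data.List.Relation.Unary.All.Properties as All
open import Data.List.Relation.Unary.AllPairs using (AllPairs; []; _∷_)
import Data.List.Relation.Unary.AllPairs.Properties as AllPairs
open import Data.List.Relation.Unary.Any as Any using (Any; here; there)
open import Data.List.Relation.Unary.Linked as Linked using (Linked; [-]; _∷_)
open import Data.List.Relation.Unary.Unique.Propositional using (Unique)
import Data.List.Relation.Unary.Unique.Propositional.Properties as Unique
open import Data.List.Relation.Binary.Permutation.Propositional
  using (_↭_; ↭-refl; ↭-sym; ↭-trans; swap; ↭⇒↭ₛ)
import Data.List.Relation.Binary.Permutation.Propositional.Properties as ↭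
open import Data.List.Relation.Binary.Sublist.Propositional using (_⊆_; _∷_; _∷ʳ_; from∈; ⊆-refl; ⊆-trans)
import Data.List.Relation.Binary.Sublist.Propositional.Properties as Sublist
import Data.List.Relation.Binary.Subset.Propositional.Properties as Subset
open import Data.Maybe using (just; nothing)
open import Data.Nat using (ℕ; suc; _+_; _*_; _<_; _≤_; _≮_; _>_; _<ᵇ_; s≤s; z≤n; _≟_; _<?_)
open import Data.Nat.Properties
open import Algebra.Properties.CommutativeSemigroup +-commutativeSemigroup using (x∙yz≈y∙xz)
open import Data.Product using (_×_; _,_; proj₁; proj₂; ∃₂)
open import Data.Sum as Sum using (_⊎_; inj₁; inj₂)
open import Function using (_∘_)
open import Relation.Binary.Construct.Closure.Transitive using (TransClosure)
open import Relation.Binary.Definitions using (tri<; tri≈; tri>)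
import Relation.Binary.PropositionalEquality as ≡
open ≡ using (_≡_; _≢_; refl; sym; trans; cong; subst; subst₂)
open import Relation.Nullary using (Dec; yes; no; contradiction)
open import Relation.Nullary.Reflects using (ofʸ; ofⁿ)
open import Data.List.Relation.Binary.Permutation.Setoid.Properties (≡.setoid ℕ) using (Unique-resp-↭)
open import Data.List.Membership.DecPropositional _≟_ using (_∈?_)

-- Schensted row insertion

insertRow-< : ∀ {x z} zs → x < z → insertRow x (z ∷ zs) ≡ (x ∷ zs , just z)
insertRow-< {x} {z} zs x<z with x <ᵇ z | <ᵇ-reflects-< x z
... | true  | _        = refl
... | false | ofⁿ x≮z = contradiction x<z x≮z

insertRow-≮ : ∀ {x z} zs → x ≮ z →
  insertRow x (z ∷ zs) ≡ (z ∷ proj₁ (insertRow x zs) , proj₂ (insertRow x zs))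
insertRow-≮ {x} {z} zs x≮z with x <ᵇ z | <ᵇ-reflects-< x z
... | true  | ofʸ x<z = contradiction x<z x≮z
... | false | _       = refl

insertRow-++-all≮ : ∀ {x} A B → All (x ≮_) A →
  insertRow x (A ++ B) ≡ (A ++ proj₁ (insertRow x B) , proj₂ (insertRow x B))
insertRow-++-all≮ []      B []            = refl
insertRow-++-all≮ (a ∷ A) B (x≮a ∷ x≮A)
  rewrite insertRow-≮ (A ++ B) x≮a | insertRow-++-all≮ A B x≮A = refl

insertRow-all≮ : ∀ {x} R → All (x ≮_) R → insertRow x R ≡ (R ++ [ x ] , nothing)
insertRow-all≮ []      []          = refl
insertRow-all≮ (z ∷ R) (x≮z ∷ x≮R) rewrite insertRow-≮ R x≮z | insertRow-all≮ R x≮R = refl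

insertRow-bump : ∀ {x c} A B → All (x ≮_) A → x < c →
  insertRow x (A ++ c ∷ B) ≡ (A ++ x ∷ B , just c)
insertRow-bump {c = c} A B x≮A x<c rewrite insertRow-++-all≮ A (c ∷ B) x≮A | insertRow-< B x<c = refl

insertRow-bump-++ : ∀ {x c} A B C → All (x ≮_) A → x < c →
  insertRow x ((A ++ c ∷ B) ++ C) ≡ ((A ++ x ∷ B) ++ C , just c)
insertRow-bump-++ {x} {c} A B C x≮A x<c
  rewrite ++-assoc A (c ∷ B) C | ++-assoc A (x ∷ B) C = insertRow-bump A (B ++ C) x≮A x<c

insertRow-max : ∀ {x} R → All (_< x) R → insertRow x R ≡ (R ++ [ x ] , nothing)
insertRow-max R R<x = insertRow-all≮ R (All.map <⇒≯ R<x)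

data InsertRowView (x : ℕ) : List ℕ → Set where
  append : ∀ {R} → All (x ≮_) R → InsertRowView x R
  bump   : ∀ A {c} B → All (x ≮_) A → x < c → InsertRowView x (A ++ c ∷ B)

insertRowView : ∀ x R → InsertRowView x R
insertRowView x []       = append []
insertRowView x (z ∷ zs) with x <? z
... | yes x<z = bump [] zs [] x<z
... | no  x≮z with insertRowView x zs
...   | append x≮zs         = append (x≮z ∷ x≮zs)
...   | bump A B x≮A x<c    = bump (z ∷ A) B (x≮z ∷ x≮A) x<c

insertRow-bumped : ∀ {x R R' c} → insertRow x R ≡ (R' , just c) → c ∈ R × x < c
insertRow-bumped {x} {R} eq with insertRowView x R
... | append x≮R with () ← trans (sym eq) (insertRow-all≮ R x≮R)
... | bump A B x≮A x<c with refl ← trans (sym eq) (insertRow-bump A B x≮A x<c) =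
  ∈-++⁺ʳ A (here refl) , x<c

∈-replaced : ∀ {y x c : ℕ} A B → y ∈ A ++ x ∷ B → y ≡ x ⊎ y ∈ A ++ c ∷ B
∈-replaced A B y∈ with ∈-++⁻ A y∈
... | inj₁ y∈A          = inj₂ (∈-++⁺ˡ y∈A)
... | inj₂ (here y≡x)   = inj₁ y≡x
... | inj₂ (there y∈B)  = inj₂ (∈-++⁺ʳ A (there y∈B))

All-replace : ∀ {P : ℕ → Set} {x c} A B → All P (A ++ c ∷ B) → P x → All P (A ++ x ∷ B)
All-replace A B all px = All.++⁺ (All.++⁻ˡ A all) (px ∷ All.tail (All.++⁻ʳ A all))

insertRow-All : ∀ {P : ℕ → Set} {x} R → P x → All P R → All P (proj₁ (insertRow x R))
insertRow-All {x = x} R px all with insertRowView x R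
... | append x≮R rewrite insertRow-all≮ R x≮R = All.++⁺ all (px ∷ [])
... | bump A B x≮A x<c rewrite insertRow-bump A B x≮A x<c = All-replace A B all px

Sorted : List ℕ → Set
Sorted = AllPairs _≤_

sorted-append : ∀ {x} R → Sorted R → All (x ≮_) R → Sorted (R ++ [ x ])
sorted-append R sorted x≮R = AllPairs.++⁺ sorted ([] ∷ []) (All.map (λ x≮y → ≮⇒≥ x≮y ∷ []) x≮R)

sorted-replace : ∀ {x c} A B → Sorted (A ++ c ∷ B) → All (x ≮_) A → x < c → Sorted (A ++ x ∷ B)
sorted-replace []      B (c≤B ∷ sorted) []          x<c = All.map (≤-trans (<⇒≤ x<c)) c≤B ∷ sorted
sorted-replace (a ∷ A) B (a≤ ∷ sorted)  (x≮a ∷ x≮A) x<c =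
  All-replace A B a≤ (≮⇒≥ x≮a) ∷ sorted-replace A B sorted x≮A x<c

sorted-≤-after : ∀ {c B} A → Sorted (A ++ c ∷ B) → All (c ≤_) B
sorted-≤-after []      (c≤B ∷ _)  = c≤B
sorted-≤-after (_ ∷ A) (_ ∷ sorted) = sorted-≤-after A sorted

<bumped⇒≤inserted : ∀ {x c y} A B → Sorted (A ++ c ∷ B) → All (x ≮_) A →
  y ∈ A ++ c ∷ B → y < c → y ≤ x
<bumped⇒≤inserted A B sorted x≮A y∈ y<c with ∈-++⁻ A y∈
... | inj₁ y∈A          = ≮⇒≥ (All.lookup x≮A y∈A)
... | inj₂ (here refl)  = contradiction y<c (<-irrefl refl)
... | inj₂ (there y∈B)  = contradiction (All.lookup c≤B y∈B) (<⇒≱ y<c)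
  where
  c≤B : All (_ ≤_) B
  c≤B = sorted-≤-after A sorted

-- Insertion tableaux of 321-avoiding words

Rows : Set
Rows = List ℕ × List ℕ

row₁ row₂ : Rows → List ℕ
row₁ = proj₁
row₂ = proj₂

infixl 5 _⟵_

_⟵_ : Rows → ℕ → Rows
(R₁ , R₂) ⟵ x = proj₁ (insertRow x R₁) , R₂ ++ fromMaybe (proj₂ (insertRow x R₁))

rows : List ℕ → Rows
rows = foldl _⟵_ ([] , [])

⟵-insertRow : ∀ {x R₁ R₂ R₁' b} → insertRow x R₁ ≡ (R₁' , b) →
  (R₁ , R₂) ⟵ x ≡ (R₁' , R₂ ++ fromMaybe b)
⟵-insertRow {R₂ = R₂} = cong (λ i → proj₁ i , R₂ ++ fromMaybe (proj₂ i))

⟵-unbumped : ∀ {x R₁ R₂ R₁'} → insertRow x R₁ ≡ (R₁' , nothing) → (R₁ , R₂) ⟵ x ≡ (R₁' , R₂)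
⟵-unbumped {x} {R₁} {R₂} eq = trans (⟵-insertRow {x} {R₁} {R₂} eq) (cong (_ ,_) (++-identityʳ _))

row₂-grows : ∀ r {s} → row₂ s ⊆ˢ row₂ (foldl _⟵_ s r)
row₂-grows []      m∈ = m∈
row₂-grows (x ∷ r) m∈ = row₂-grows r (∈-++⁺ˡ m∈)

InversionAbove : List ℕ → ℕ → Set
InversionAbove u y = ∃₂ λ a b → a ∷ b ∷ [] ⊆ u × b < a × y ≤ b

inversionAbove-++ : ∀ {u y} v → InversionAbove u y → InversionAbove (u ++ v) y
inversionAbove-++ v (a , b , ab⊆u , b<a , y≤b) = a , b , Sublist.++⁺ʳ v ab⊆u , b<a , y≤b

inversionAbove-last : ∀ {u e x y} → e ∈ u → x < e → y ≤ x → InversionAbove (u ++ [ x ]) y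
inversionAbove-last e∈u x<e y≤x = _ , _ , Sublist.++⁺ (from∈ e∈u) ⊆-refl , x<e , y≤x

record RowInvariant (u : List ℕ) (s : Rows) : Set where
  constructor rowInvariant
  field
    sorted₁         : Sorted (row₁ s)
    row₁⊆           : row₁ s ⊆ˢ u
    row₂⊆           : row₂ s ⊆ˢ u
    inversion-below : ∀ {y e} → y ∈ row₁ s → e ∈ row₂ s → y < e → InversionAbove u y

open RowInvariant

rowInvariant-[] : RowInvariant [] ([] , [])
rowInvariant-[] = rowInvariant [] (λ ()) (λ ()) (λ ())

rowInvariant-⟵ : ∀ {u x R₁ R₂} → RowInvariant u (R₁ , R₂) → RowInvariant (u ++ [ x ]) ((R₁ , R₂) ⟵ x)
rowInvariant-⟵ {u} {x} {R₁} {R₂} inv with insertRowView x R₁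
... | append x≮R₁ =
  subst (RowInvariant (u ++ [ x ])) (sym (⟵-insertRow {x} {R₁} {R₂} (insertRow-all≮ R₁ x≮R₁))) new
  where
  new : RowInvariant (u ++ [ x ]) (R₁ ++ [ x ] , R₂ ++ [])
  new .sorted₁ = sorted-append R₁ (inv .sorted₁) x≮R₁
  new .row₁⊆ = Subset.++⁺ (inv .row₁⊆) (λ m∈ → m∈)
  new .row₂⊆ = Subset.++⁺ (inv .row₂⊆) (λ ())
  new .inversion-below y∈ e∈ y<e with ∈-++⁻ R₂ e∈
  ... | inj₂ ()
  ... | inj₁ e∈R₂ with ∈-++⁻ R₁ y∈
  ...   | inj₁ y∈R₁         = inversionAbove-++ [ x ] (inv .inversion-below y∈R₁ e∈R₂ y<e)
  ...   | inj₂ (here refl)  = inversionAbove-last (inv .row₂⊆ e∈R₂) y<e ≤-refl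
... | bump A {c} B x≮A x<c =
  subst (RowInvariant (u ++ [ x ])) (sym (⟵-insertRow {x} {A ++ c ∷ B} {R₂} (insertRow-bump A B x≮A x<c))) new
  where
  c∈u : c ∈ u
  c∈u = inv .row₁⊆ (∈-++⁺ʳ A (here refl))
  new : RowInvariant (u ++ [ x ]) (A ++ x ∷ B , R₂ ++ [ c ])
  new .sorted₁ = sorted-replace A B (inv .sorted₁) x≮A x<c
  new .row₁⊆ y∈ with ∈-replaced A B y∈
  ... | inj₁ refl  = ∈-++⁺ʳ u (here refl)
  ... | inj₂ y∈R₁  = ∈-++⁺ˡ (inv .row₁⊆ y∈R₁)
  new .row₂⊆ m∈ with ∈-++⁻ R₂ m∈
  ... | inj₁ m∈R₂         = ∈-++⁺ˡ (inv .row₂⊆ m∈R₂)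
  ... | inj₂ (here refl)  = ∈-++⁺ˡ c∈u
  new .inversion-below {y} {e} y∈ e∈ y<e with ∈-replaced A B y∈ | ∈-++⁻ R₂ e∈
  ... | inj₁ refl | inj₁ e∈R₂         = inversionAbove-last (inv .row₂⊆ e∈R₂) y<e ≤-refl
  ... | inj₁ refl | inj₂ (here refl)  = inversionAbove-last c∈u y<e ≤-refl
  ... | inj₂ y∈R₁ | inj₁ e∈R₂         = inversionAbove-++ [ x ] (inv .inversion-below y∈R₁ e∈R₂ y<e)
  ... | inj₂ y∈R₁ | inj₂ (here refl)  =
    inversionAbove-last c∈u x<c (<bumped⇒≤inserted A B (inv .sorted₁) x≮A y∈R₁ y<e)

rowInvariant-foldl : ∀ r {u s} → RowInvariant u s → RowInvariant (u ++ r) (foldl _⟵_ s r)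
rowInvariant-foldl []          {u} inv = subst (λ v → RowInvariant v _) (sym (++-identityʳ u)) inv
rowInvariant-foldl (x ∷ r) {u} inv =
  subst (λ v → RowInvariant v _) (++-assoc u [ x ] r) (rowInvariant-foldl r (rowInvariant-⟵ inv))

rows-invariant : ∀ w → RowInvariant w (rows w)
rows-invariant w = rowInvariant-foldl w rowInvariant-[]

Avoids321-⊆ : ∀ {xs ys} → xs ⊆ ys → Avoids321 ys → Avoids321 xs
Avoids321-⊆ xs⊆ys avoids (a , b , c , cba⊆xs , b<c , a<b) =
  avoids (a , b , c , ⊆-trans cba⊆xs xs⊆ys , b<c , a<b)

Avoids321-prefix : ∀ u {r} → Avoids321 (u ++ r) → Avoids321 u
Avoids321-prefix u {r} = Avoids321-⊆ (Sublist.++⁺ʳ r ⊆-refl)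

-- This is where 321-avoidance enters: an entry of the second row above c would give, via
-- inversion-below, an inversion a > b ≥ c of u, and a b x would be a 321-pattern.
bumped-≥-row₂ : ∀ {u x R₁ R₂ R₁' c} → RowInvariant u (R₁ , R₂) → Avoids321 (u ++ [ x ]) →
  insertRow x R₁ ≡ (R₁' , just c) → All (c ≮_) R₂
bumped-≥-row₂ inv avoids bumped with insertRow-bumped bumped
... | c∈R₁ , x<c = All.tabulate λ e∈R₂ c<e →
  let a , b , ab⊆u , b<a , c≤b = inv .inversion-below c∈R₁ e∈R₂ c<e
  in avoids (_ , b , a , Sublist.++⁺ ab⊆u ⊆-refl , b<a , <-≤-trans x<c c≤b)

data Represents : List (List ℕ) → Rows → Set where
  empty   : Represents [] ([] , [])
  oneRow  : ∀ R → Represents (R ∷ []) (R , [])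
  twoRows : ∀ R b B → Represents (R ∷ (b ∷ B) ∷ []) (R , b ∷ B)

Represents-Row₂ : ∀ {T s} → Represents T s → Row₂ T ≡ row₂ s
Represents-Row₂ empty             = refl
Represents-Row₂ (oneRow _)        = refl
Represents-Row₂ (twoRows _ _ _)   = refl

Represents-insertTab : ∀ {T x R₁ R₂} → Represents T (R₁ , R₂) →
  (∀ {R₁' c} → insertRow x R₁ ≡ (R₁' , just c) → All (c ≮_) R₂) →
  Represents (insertTab x T) ((R₁ , R₂) ⟵ x)
Represents-insertTab {x = x} empty _ = oneRow [ x ]
Represents-insertTab {x = x} (oneRow R) _ with insertRow x R
... | R' , nothing = oneRow R'
... | R' , just c  = twoRows R' c []
Represents-insertTab {x = x} (twoRows R b B) c≥R₂ with insertRow x R | c≥R₂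
... | R' , nothing | _ = subst (Represents _) (cong (R' ,_) (sym (++-identityʳ (b ∷ B)))) (twoRows R' b B)
... | R' , just c  | c≥R₂′ rewrite insertRow-all≮ (b ∷ B) (c≥R₂′ refl) = twoRows R' b (B ++ [ c ])

Represents-foldl : ∀ r {u T s} → RowInvariant u s → Represents T s → Avoids321 (u ++ r) →
  Represents (foldl (λ T x → insertTab x T) T r) (foldl _⟵_ s r)
Represents-foldl []      inv rep avoids = rep
Represents-foldl (x ∷ r) {u} inv rep avoids =
  Represents-foldl r (rowInvariant-⟵ inv)
    (Represents-insertTab rep (bumped-≥-row₂ inv (Avoids321-prefix (u ++ [ x ]) avoids′)))
    avoids′
  where
  avoids′ : Avoids321 ((u ++ [ x ]) ++ r)
  avoids′ = subst Avoids321 (sym (++-assoc u [ x ] r)) avoids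

Row₂-P : ∀ w → Avoids321 w → Row₂ (P w) ≡ row₂ (rows w)
Row₂-P w avoids = Represents-Row₂ (Represents-foldl w rowInvariant-[] empty avoids)

-- Swapping a descent

↭-swap : ∀ (u : List ℕ) {p q r} → u ++ q ∷ p ∷ r ↭ u ++ p ∷ q ∷ r
↭-swap u {p} {q} = ↭.++⁺ˡ u (swap q p ↭-refl)

IsPerm⇒Unique : ∀ {n w} → IsPerm n w → Unique w
IsPerm⇒Unique {n} w↭ =
  Unique-resp-↭ (↭⇒↭ₛ (↭-sym w↭)) (Unique.map⁺ suc-injective (Unique.upTo⁺ n))

IsPerm⇒length : ∀ {n w} → IsPerm n w → length w ≡ n
IsPerm⇒length {n} w↭ = trans (↭.↭-length w↭) (trans (length-map suc (upTo n)) (length-upTo n))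

Unique⇒∉-prefix : ∀ (u : List ℕ) {p r} → Unique (u ++ p ∷ r) → p ∉ u
Unique⇒∉-prefix (_ ∷ u) (x≢ ∷ _)  (here refl) = All.lookup x≢ (∈-++⁺ʳ u (here refl)) refl
Unique⇒∉-prefix (_ ∷ u) (_ ∷ uniq) (there p∈u) = Unique⇒∉-prefix u uniq p∈u

⊆-swap : ∀ {xs} (u : List ℕ) {p q r} → q < p → Linked _>_ xs →
  xs ⊆ u ++ q ∷ p ∷ r → xs ⊆ u ++ p ∷ q ∷ r
⊆-swap []      q<p _            (_ ∷ʳ _ ∷ʳ xs⊆)    = _ ∷ʳ _ ∷ʳ xs⊆
⊆-swap []      q<p _            (_ ∷ʳ refl ∷ xs⊆)  = refl ∷ _ ∷ʳ xs⊆
⊆-swap []      q<p _            (refl ∷ _ ∷ʳ xs⊆)  = _ ∷ʳ refl ∷ xs⊆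
⊆-swap []      q<p (q>p ∷ _)    (refl ∷ refl ∷ _)  = contradiction q>p (<-asym q<p)
⊆-swap (y ∷ u) q<p decreasing   (_ ∷ʳ xs⊆)         = y ∷ʳ ⊆-swap u q<p decreasing xs⊆
⊆-swap (y ∷ u) q<p decreasing   (refl ∷ xs⊆)       = refl ∷ ⊆-swap u q<p (Linked.tail decreasing) xs⊆

Avoids321-swap : ∀ (u : List ℕ) {p q r} → q < p →
  Avoids321 (u ++ p ∷ q ∷ r) → Avoids321 (u ++ q ∷ p ∷ r)
Avoids321-swap u q<p avoids (a , b , c , cba⊆ , b<c , a<b) =
  avoids (a , b , c , ⊆-swap u q<p (b<c ∷ a<b ∷ [-]) cba⊆ , b<c , a<b)

inv-swap : ∀ (u : List ℕ) {p q r} → q < p → inv (u ++ q ∷ p ∷ r) < inv (u ++ p ∷ q ∷ r)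
inv-swap [] {p} {q} {r} q<p
  rewrite filter-reject (_<? q) {p} {r} (<⇒≯ q<p) | filter-accept (_<? p) {q} {r} q<p =
  s≤s (≤-reflexive (x∙yz≈y∙xz (length (filter (_<? q) r)) (length (filter (_<? p) r)) (inv r)))
inv-swap (y ∷ u) q<p =
  +-mono-≤-< (≤-reflexive (↭.↭-length (↭.filter-↭ (_<? y) (↭-swap u)))) (inv-swap u q<p)

length-descent : ∀ (u : List ℕ) {p q r} → 2 + length u ≤ length (u ++ p ∷ q ∷ r)
length-descent []      = s≤s (s≤s z≤n)
length-descent (_ ∷ u) = s≤s (length-descent u)

swapAt-descent : ∀ (u : List ℕ) {p q r} →
  swapAt (suc (length u)) (u ++ q ∷ p ∷ r) ≡ u ++ p ∷ q ∷ r
swapAt-descent []      = refl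
swapAt-descent (x ∷ u) = cong (x ∷_) (swapAt-descent u)

WeakStep-swap : ∀ n (u : List ℕ) {p q r} → length (u ++ p ∷ q ∷ r) ≡ n → q < p →
  WeakStep n (u ++ q ∷ p ∷ r) (u ++ p ∷ q ∷ r)
WeakStep-swap n u length≡n q<p =
  suc (length u) , s≤s z≤n , subst (_ ≤_) length≡n (length-descent u) ,
  sym (swapAt-descent u) , inv-swap u q<p

before-descent-< : ∀ (u : List ℕ) {p q r} → Avoids321 (u ++ p ∷ q ∷ r) → Unique (u ++ p ∷ q ∷ r) →
  q < p → All (_< p) u
before-descent-< u {p} avoids uniq q<p = All.tabulate below
  where
  below : ∀ {e} → e ∈ u → e < p
  below {e} e∈u with <-cmp e p
  ... | tri< e<p _ _ = e<p
  ... | tri≈ _ refl _ = contradiction e∈u (Unique⇒∉-prefix u uniq)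
  ... | tri> _ _ p<e =
    ⊥-elim (avoids (_ , p , e , Sublist.++⁺ (from∈ e∈u) (refl ∷ refl ∷ Sublist.[]⊆-universal _) , p<e , q<p))

-- Descents after the largest entry of the second row

∈-bumped⇒> : ∀ {x m} R → m ∈ fromMaybe (proj₂ (insertRow x R)) → x < m
∈-bumped⇒> {x} R m∈ with insertRow x R in eq
∈-bumped⇒> R ()          | _ , nothing
∈-bumped⇒> R (here refl) | _ , just _ = proj₂ (insertRow-bumped {R = R} eq)

row₂-foldl-> : ∀ {M} r {s m} → All (M ≤_) r → m ∈ row₂ (foldl _⟵_ s r) → m ∈ row₂ s ⊎ M < m
row₂-foldl-> []      _           m∈ = inj₁ m∈
row₂-foldl-> (x ∷ r) {R₁ , R₂} (M≤x ∷ M≤r) m∈ with row₂-foldl-> r M≤r m∈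
... | inj₂ M<m = inj₂ M<m
... | inj₁ m∈′ with ∈-++⁻ R₂ m∈′
...   | inj₁ m∈R₂     = inj₁ m∈R₂
...   | inj₂ m∈bumped = inj₂ (≤-<-trans M≤x (∈-bumped⇒> R₁ m∈bumped))

record DescentAfter (M : ℕ) (w : List ℕ) : Set where
  constructor descentAfter
  field
    before : List ℕ
    p q    : ℕ
    after  : List ℕ
    split  : w ≡ before ++ p ∷ q ∷ after
    q<p    : q < p
    M-before : p ≡ M ⊎ M ∈ before

ascending-or-descent : ∀ a xs → All (a ≤_) xs ⊎ DescentAfter a (a ∷ xs)
ascending-or-descent a []       = inj₁ []
ascending-or-descent a (b ∷ xs) with b <? a
... | yes b<a = inj₂ (descentAfter [] a b xs refl b<a (inj₁ refl))
... | no  b≮a with ascending-or-descent b xs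
...   | inj₁ b≤xs = inj₁ (≮⇒≥ b≮a ∷ All.map (≤-trans (≮⇒≥ b≮a)) b≤xs)
...   | inj₂ (descentAfter u p q r split q<p _) =
  inj₂ (descentAfter (a ∷ u) p q r (cong (a ∷_) split) q<p (inj₂ (here refl)))

DescentAfter-++ : ∀ v {M w} → DescentAfter M w → DescentAfter M (v ++ w)
DescentAfter-++ v (descentAfter u p q r refl q<p M-before) =
  descentAfter (v ++ u) p q r (sym (++-assoc v u _)) q<p (Sum.map₂ (∈-++⁺ʳ v) M-before)

-- An entry only enters the second row when bumped by a smaller entry inserted after it.
row₂-DescentAfter : ∀ w {M} → Unique w → M ∈ row₂ (rows w) → DescentAfter M w
row₂-DescentAfter w {M} uniq M∈ with ∈-∃++ (rows-invariant w .row₂⊆ M∈)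
... | u , r , refl with ascending-or-descent M r
...   | inj₂ descent = DescentAfter-++ u descent
...   | inj₁ M≤r
  with row₂-foldl-> (M ∷ r) {rows u} (≤-refl ∷ M≤r)
         (subst (λ s → M ∈ row₂ s) (foldl-++ _⟵_ ([] , []) u (M ∷ r)) M∈)
...     | inj₁ M∈u = contradiction (rows-invariant u .row₂⊆ M∈u) (Unique⇒∉-prefix u uniq)
...     | inj₂ M<M = contradiction M<M (<-irrefl refl)

-- Delaying an entry of the second row

data RowShift (M : ℕ) : List ℕ → List ℕ → Set where
  same    : ∀ {R} → RowShift M R R
  shifted : ∀ A B → All (M ≤_) B → RowShift M (A ++ B) (A ++ M ∷ B)

Covers : ℕ → List ℕ → List ℕ → Set
Covers M B B' = ∀ {m} → m ∈ B → m ≢ M → m ∈ B'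

Covers-++ : ∀ {M B B' D D'} → Covers M B B' → D ⊆ˢ D' → Covers M (B ++ D) (B' ++ D')
Covers-++ {B = B} covers D⊆D' m∈ m≢M with ∈-++⁻ B m∈
... | inj₁ m∈B = ∈-++⁺ˡ (covers m∈B m≢M)
... | inj₂ m∈D = ∈-++⁺ʳ _ (D⊆D' m∈D)

-- t is s with M held back in the first row instead of bumped into the second.
record Delayed (M : ℕ) (s t : Rows) : Set where
  constructor delayed
  field
    shift  : RowShift M (row₁ s) (row₁ t)
    covers : Covers M (row₂ s) (row₂ t)

Delayed-⟵-via : ∀ {M} x Rw Rv {Bw Bv Rw' Rv' bw bv} →
  insertRow x Rw ≡ (Rw' , bw) → insertRow x Rv ≡ (Rv' , bv) →
  RowShift M Rw' Rv' → Covers M Bw Bv → fromMaybe bw ⊆ˢ fromMaybe bv →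
  Delayed M ((Rw , Bw) ⟵ x) ((Rv , Bv) ⟵ x)
Delayed-⟵-via {M} x Rw Rv {Bw} {Bv} eqw eqv shift covers bw⊆bv =
  subst₂ (Delayed M) (sym (⟵-insertRow {x} {Rw} {Bw} eqw)) (sym (⟵-insertRow {x} {Rv} {Bv} eqv))
    (delayed shift (Covers-++ covers bw⊆bv))

-- Inserting x < M bumps M out of t; in s it bumps some a ≥ M, which the bound forces to be M.
Delayed-⟵-< : ∀ {M x} A B {Bw Bv} → All (x ≮_) A → All (M ≤_) B → x < M → Covers M Bw Bv →
  (∀ {m} → m ∈ row₂ ((A ++ B , Bw) ⟵ x) → m ≤ M) →
  Delayed M ((A ++ B , Bw) ⟵ x) ((A ++ M ∷ B , Bv) ⟵ x)
Delayed-⟵-< {M} {x} A [] x≮A [] x<M covers _ =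
  Delayed-⟵-via x (A ++ []) (A ++ M ∷ []) (insertRow-++-all≮ A [] x≮A) (insertRow-bump A [] x≮A x<M)
    same covers (λ ())
Delayed-⟵-< {M} {x} A (a ∷ B) {Bw} x≮A (M≤a ∷ M≤B) x<M covers bound
  with ≤-antisym (bound (subst (λ s → a ∈ row₂ s) (sym (⟵-insertRow {x} {A ++ a ∷ B} {Bw} bumps-a))
                                (∈-++⁺ʳ Bw (here refl))))
                  M≤a
  where
  bumps-a : insertRow x (A ++ a ∷ B) ≡ (A ++ x ∷ B , just a)
  bumps-a = insertRow-bump A B x≮A (<-≤-trans x<M M≤a)
... | refl =
  Delayed-⟵-via x (A ++ M ∷ B) (A ++ M ∷ M ∷ B) (insertRow-bump A B x≮A x<M) (insertRow-bump A (M ∷ B) x≮A x<M)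
    (subst₂ (RowShift M) (++-assoc A [ x ] B) (++-assoc A [ x ] (M ∷ B)) (shifted (A ++ [ x ]) B M≤B))
    covers (λ m∈ → m∈)

Delayed-⟵ : ∀ {M x Rw Bw Rv Bv} → Delayed M (Rw , Bw) (Rv , Bv) →
  (∀ {m} → m ∈ row₂ ((Rw , Bw) ⟵ x) → m ≤ M) → Delayed M ((Rw , Bw) ⟵ x) ((Rv , Bv) ⟵ x)
Delayed-⟵ {x = x} {Rw} (delayed same covers) _ =
  Delayed-⟵-via x Rw Rw refl refl same covers (λ m∈ → m∈)
Delayed-⟵ {M} {x} (delayed (shifted A B M≤B) covers) bound with insertRowView x A
... | bump A₀ {c} B₀ x≮A₀ x<c =
  Delayed-⟵-via x ((A₀ ++ c ∷ B₀) ++ B) ((A₀ ++ c ∷ B₀) ++ M ∷ B)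
    (insertRow-bump-++ A₀ B₀ B x≮A₀ x<c) (insertRow-bump-++ A₀ B₀ (M ∷ B) x≮A₀ x<c)
    (shifted _ B M≤B) covers (λ m∈ → m∈)
... | append x≮A with x <? M
...   | yes x<M = Delayed-⟵-< A B x≮A M≤B x<M covers bound
...   | no  x≮M =
  Delayed-⟵-via x (A ++ B) (A ++ M ∷ B) (insertRow-++-all≮ A B x≮A)
    (trans (insertRow-++-all≮ A (M ∷ B) x≮A) (cong (λ i → A ++ proj₁ i , proj₂ i) (insertRow-≮ B x≮M)))
    (shifted A _ (insertRow-All B (≮⇒≥ x≮M) M≤B)) covers (λ m∈ → m∈)

Delayed-foldl : ∀ {M} r {s t} → Delayed M s t → (∀ {m} → m ∈ row₂ (foldl _⟵_ s r) → m ≤ M) →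
  Delayed M (foldl _⟵_ s r) (foldl _⟵_ t r)
Delayed-foldl []      delay _     = delay
Delayed-foldl (x ∷ r) delay bound = Delayed-foldl r (Delayed-⟵ delay (bound ∘ row₂-grows r)) bound

⟵-swap : ∀ {p q} R₁ R₂ → All (_< p) R₁ → q < p →
    (R₁ , R₂) ⟵ q ⟵ p ≡ (R₁ , R₂) ⟵ p ⟵ q
  ⊎ p ∈ row₂ ((R₁ , R₂) ⟵ p ⟵ q) × Delayed p ((R₁ , R₂) ⟵ p ⟵ q) ((R₁ , R₂) ⟵ q ⟵ p)
⟵-swap {p} {q} R₁ R₂ R₁<p q<p with insertRowView q R₁
... | append q≮R₁ =
  inj₂ (subst (λ s → p ∈ row₂ s) (sym p-first) (∈-++⁺ʳ R₂ (here refl)) ,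
        subst₂ (Delayed p) (sym p-first) (sym q-first) (delayed shift covers))
  where
  p-first : (R₁ , R₂) ⟵ p ⟵ q ≡ (R₁ ++ [ q ] , R₂ ++ [ p ])
  p-first = trans (cong (_⟵ q) (⟵-unbumped {p} {R₁} {R₂} (insertRow-max R₁ R₁<p)))
                  (⟵-insertRow {q} {R₁ ++ [ p ]} {R₂} (insertRow-bump R₁ [] q≮R₁ q<p))
  q-first : (R₁ , R₂) ⟵ q ⟵ p ≡ ((R₁ ++ [ q ]) ++ [ p ] , R₂)
  q-first = trans (cong (_⟵ p) (⟵-unbumped {q} {R₁} {R₂} (insertRow-all≮ R₁ q≮R₁)))
                  (⟵-unbumped {p} {R₁ ++ [ q ]} {R₂}
                     (insertRow-max (R₁ ++ [ q ]) (All.++⁺ R₁<p (q<p ∷ []))))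
  shift : RowShift p (R₁ ++ [ q ]) ((R₁ ++ [ q ]) ++ [ p ])
  shift = subst (λ R → RowShift p R ((R₁ ++ [ q ]) ++ [ p ])) (++-identityʳ _)
            (shifted (R₁ ++ [ q ]) [] [])
  covers : Covers p (R₂ ++ [ p ]) R₂
  covers m∈ m≢p with ∈-++⁻ R₂ m∈
  ... | inj₁ m∈R₂        = m∈R₂
  ... | inj₂ (here refl) = contradiction refl m≢p
... | bump A {c} B q≮A q<c = inj₁ (trans q-first (sym p-first))
  where
  bumps : insertRow q (A ++ c ∷ B) ≡ (A ++ q ∷ B , just c)
  bumps = insertRow-bump A B q≮A q<c
  p-first : (A ++ c ∷ B , R₂) ⟵ p ⟵ q ≡ ((A ++ q ∷ B) ++ [ p ] , R₂ ++ [ c ])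
  p-first = trans (cong (_⟵ q) (⟵-unbumped {p} {A ++ c ∷ B} {R₂} (insertRow-max (A ++ c ∷ B) R₁<p)))
                  (⟵-insertRow {q} {(A ++ c ∷ B) ++ [ p ]} {R₂}
                     (insertRow-bump-++ A B [ p ] q≮A q<c))
  q-first : (A ++ c ∷ B , R₂) ⟵ q ⟵ p ≡ ((A ++ q ∷ B) ++ [ p ] , R₂ ++ [ c ])
  q-first = trans (cong (_⟵ p) (⟵-insertRow {q} {A ++ c ∷ B} {R₂} bumps))
                  (⟵-unbumped {p} {A ++ q ∷ B} {R₂ ++ [ c ]}
                     (insertRow-max (A ++ q ∷ B) (All-replace A B R₁<p q<p)))

rows-swap : ∀ (u : List ℕ) {p q r M} → Avoids321 (u ++ p ∷ q ∷ r) → Unique (u ++ p ∷ q ∷ r) →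
  q < p → p ≡ M ⊎ M ∈ u → (∀ {m} → m ∈ row₂ (rows (u ++ p ∷ q ∷ r)) → m ≤ M) →
    rows (u ++ q ∷ p ∷ r) ≡ rows (u ++ p ∷ q ∷ r)
  ⊎ Delayed M (rows (u ++ p ∷ q ∷ r)) (rows (u ++ q ∷ p ∷ r))
rows-swap u {p} {q} {r} avoids uniq q<p M-before bound
  rewrite foldl-++ _⟵_ ([] , []) u (p ∷ q ∷ r) | foldl-++ _⟵_ ([] , []) u (q ∷ p ∷ r)
  with before-descent-< u avoids uniq q<p
... | u<p
  with ⟵-swap (row₁ (rows u)) (row₂ (rows u)) (All.tabulate (All.lookup u<p ∘ rows-invariant u .row₁⊆)) q<p
...   | inj₁ commute = inj₁ (cong (λ s → foldl _⟵_ s r) commute)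
...   | inj₂ (p∈ , delay) with M-before
...     | inj₁ refl = inj₂ (Delayed-foldl r delay bound)
...     | inj₂ M∈u  = contradiction (bound (row₂-grows r p∈)) (<⇒≱ (All.lookup u<p M∈u))

-- Crowded sets

countIn-mono : ∀ {S L} x y → S ⊆ˢ L → countIn x y S ≤ countIn x y L
countIn-mono {S} {L} x y S⊆L =
  Sublist.length-mono-≤
    (Sublist.filter⁺ (hits S) (hits L) (λ { refl → Subset.Any-resp-⊆ S⊆L }) (⊆-refl {x = upTo (suc (2 * x))}))
  where
  hits : ∀ T t → Dec (Any (λ m → + m ≡ y ℤ.+ + t) T)
  hits T t = Any.any? (λ m → + m ℤ.≟ y ℤ.+ + t) T

Crowded-mono : ∀ {S L} → S ⊆ˢ L → Crowded S → Crowded L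
Crowded-mono S⊆L (x , y , 0<x , x+1<count) =
  x , y , 0<x , <-≤-trans x+1<count (countIn-mono x y S⊆L)

swap-InC : ∀ n (u : List ℕ) {p q r M S} → InC n (u ++ p ∷ q ∷ r) → q < p → p ≡ M ⊎ M ∈ u →
  (∀ m → m ∈ Row₂ (P (u ++ p ∷ q ∷ r)) → m ≤ M) →
  S ⊆ˢ Row₂ (P (u ++ p ∷ q ∷ r)) → Crowded S → M ∉ S → InC n (u ++ q ∷ p ∷ r)
swap-InC n u {p} {q} {r} {M} {S} (w-perm , w-avoids , w-crowded) q<p M-before M-max S⊆ S-crowded M∉S =
  ↭-trans (↭-swap u) w-perm , v-avoids , v-crowded
  where
  v-avoids : Avoids321 (u ++ q ∷ p ∷ r)
  v-avoids = Avoids321-swap u q<p w-avoids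
  Row₂-w : Row₂ (P (u ++ p ∷ q ∷ r)) ≡ row₂ (rows (u ++ p ∷ q ∷ r))
  Row₂-w = Row₂-P (u ++ p ∷ q ∷ r) w-avoids
  Row₂-v : Row₂ (P (u ++ q ∷ p ∷ r)) ≡ row₂ (rows (u ++ q ∷ p ∷ r))
  Row₂-v = Row₂-P (u ++ q ∷ p ∷ r) v-avoids
  v-crowded : Crowded (Row₂ (P (u ++ q ∷ p ∷ r)))
  v-crowded
    with rows-swap u w-avoids (IsPerm⇒Unique w-perm) q<p M-before (λ m∈ → M-max _ (subst (_ ∈_) (sym Row₂-w) m∈))
  ... | inj₁ same-rows =
    subst Crowded (trans Row₂-w (trans (cong row₂ (sym same-rows)) (sym Row₂-v))) w-crowded
  ... | inj₂ delay     = Crowded-mono S⊆Row₂-v S-crowded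
    where
    S⊆Row₂-v : S ⊆ˢ Row₂ (P (u ++ q ∷ p ∷ r))
    S⊆Row₂-v m∈S = subst (_ ∈_) (sym Row₂-v)
      (Delayed.covers delay (subst (_ ∈_) Row₂-w (S⊆ m∈S)) λ { refl → M∉S m∈S })

lemma5p10 : (n : ℕ) (w : List ℕ) → MinimalC n w →
    (S : List ℕ) → S ⊆ˢ Row₂ (P w) → Crowded S →
    (M : ℕ) → M ∈ Row₂ (P w) → (∀ m → m ∈ Row₂ (P w) → m ≤ M) → M ∈ S
lemma5p10 n w (w∈C@(w-perm , w-avoids , _) , w-minimal) S S⊆ S-crowded M M∈ M-max with M ∈? S
... | yes M∈S = M∈S
... | no  M∉S with row₂-DescentAfter w (IsPerm⇒Unique w-perm) (subst (M ∈_) (Row₂-P w w-avoids) M∈)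
...   | descentAfter u p q r refl q<p M-before =
  ⊥-elim (w-minimal _ (swap-InC n u w∈C q<p M-before M-max S⊆ S-crowded M∉S)
    (TransClosure.[_] (WeakStep-swap n u (IsPerm⇒length w-perm) q<p)))
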